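{- Let $\mathcal S=(\mathcal P,\mathcal L)$ be a finite thick generalized quadrangle of order $(s,t)$ and $G$ an automorphism group of $\mathcal S$ acting regularly on $\mathcal P$, with $\mathcal P$ identified with $G$ as in the context. Let $\theta\in\mathrm{Aut}(G)$ be a multiplier of $\mathcal S$ of order $2$ or $3$, let $H=C_G(\theta)$, $X=\{g^\theta g^{ -1}:g\in G\}$, and let $c$ be the number of lines fixed by $\theta$ that are incident with the point $1$. Then: (1) $H$ acts semiregularly on $\mathcal L_1(\theta)$; (2) $|\mathcal L_0(\theta)|=\frac{|H|}{1+s}\bigl(c+|X\cap\Delta|\bigr)$ and $|\mathcal L_1(\theta)|=(t+1-c)|H|$.
   Context: A finite generalized quadrangle of order $(s,t)$ is a point-line incidence structure whose incidence graph is bipartite of diameter $4$ and girth $8$, with $s+1$ points on every line and $t+1$ lines through every point; thick means $s,t\ge2$. Fix a point $p$ and identify $\mathcal P$ with $G$ via $p^g\mapsto g$; $G$ acts on $\mathcal P=G$ by right multiplication. Write $x\sim y$ if points $x,y$ are equal or collinear; $\Delta=\{g\in G\setminus\{1\}:1\sim g\}$. An automorphism $\theta$ of the group $G$ is a multiplier if $g\mapsto g^\theta$ induces an automorphism of $\mathcal S$. For an automorphism $\theta$ of $\mathcal S$, $\mathcal L_0(\theta)$ is the set of lines fixed by $\theta$ and $\mathcal L_1(\theta)$ is the set of lines $\ell$ with $\ell^\theta\ne\ell$ and $\ell^\theta$ concurrent with $\ell$. $C_G(\theta)=\{g\in G:g^\theta=g\}$. -}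

module Defs where

open import Data.Nat using (ℕ; zero; suc; _+_; _≤_)
open import Level using (Level)
open import Data.Bool using (Bool; true; false; if_then_else_)
open import Data.Fin using (Fin; _≟_)
import Data.Fin as F
open import Data.Fin.Properties using (any?)
open import Data.Product using (Σ; ∃; _×_; _,_)
open import Data.Empty using (⊥)
open import Data.Sum using (_⊎_)
import Data.Bool as B
open import Relation.Nullary using (¬_; Dec; does)
open import Relation.Nullary.Decidable using (_×-dec_; ¬?)
open import Relation.Unary using (Pred; Decidable)
open import Relation.Binary.PropositionalEquality using (_≡_; _≢_)
open import Function.Definitions using (Bijective)
open import Algebra.Structures using (IsGroup)

count : ∀ {n p} {P : Pred (Fin n) p} → Decidable P → ℕ
count {zero} P? = 0
count {suc n} P? = (if does (P? F.zero) then 1 else 0) + count (λ i → P? (F.suc i))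

Incidence : ℕ → ℕ → Set
Incidence np nl = Fin np → Fin nl → Bool

module _ {np nl : ℕ} (Inc : Incidence np nl) where

  _I_ : Fin np → Fin nl → Set
  x I ℓ = Inc x ℓ ≡ true

  _I?_ : (x : Fin np) → (ℓ : Fin nl) → Dec (x I ℓ)
  x I? ℓ = Inc x ℓ B.≟ true

  -- Generalized quadrangle of order (s,t): s+1 points per line, t+1 lines
  -- per point, incidence graph (bipartite) of diameter 4 and girth 8.
  record IsGQ (s t : ℕ) : Set where
    field
      points-per-line : ∀ ℓ → count (λ x → x I? ℓ) ≡ suc s
      lines-per-point : ∀ x → count (λ ℓ → x I? ℓ) ≡ suc t
      diam-pp : ∀ x y → ∃ λ m → ∃ λ z → ∃ λ n →
                  x I m × z I m × z I n × y I n
      diam-pl : ∀ x ℓ → ∃ λ m → ∃ λ z → x I m × z I m × z I ℓ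
      diam-ll : ∀ ℓ ℓ' → ∃ λ z → ∃ λ m → ∃ λ w →
                  z I ℓ × z I m × w I m × w I ℓ'
      no-4-cycle : ∀ x y m n → x ≢ y → m ≢ n →
                   x I m → y I m → x I n → y I n → ⊥
      no-6-cycle : ∀ x y z l m n → x ≢ y → y ≢ z → x ≢ z →
                   l ≢ m → m ≢ n → l ≢ n →
                   x I l → y I l → y I m → z I m → z I n → x I n → ⊥
      diam-exact : ∃ λ x → ∃ λ y → ¬ (∃ λ m → x I m × y I m)
      has-8-cycle : Σ (Fin np × Fin np × Fin np × Fin np) λ { (x₁ , x₂ , x₃ , x₄) →
                    Σ (Fin nl × Fin nl × Fin nl × Fin nl) λ { (l₁ , l₂ , l₃ , l₄) →
                    x₁ ≢ x₂ × x₁ ≢ x₃ × x₁ ≢ x₄ × x₂ ≢ x₃ × x₂ ≢ x₄ × x₃ ≢ x₄ ×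
                    l₁ ≢ l₂ × l₁ ≢ l₃ × l₁ ≢ l₄ × l₂ ≢ l₃ × l₂ ≢ l₄ × l₃ ≢ l₄ ×
                    x₁ I l₁ × x₂ I l₁ × x₂ I l₂ × x₃ I l₂ ×
                    x₃ I l₃ × x₄ I l₃ × x₄ I l₄ × x₁ I l₄ } }

  record IsAutomorphism (f : Fin np → Fin np) : Set where
    field
      lineMap    : Fin nl → Fin nl
      point-bij  : Bijective _≡_ _≡_ f
      line-bij   : Bijective _≡_ _≡_ lineMap
      preserves  : ∀ x ℓ → Inc x ℓ ≡ Inc (f x) (lineMap ℓ)

record FinGroup (n : ℕ) : Set where
  field
    _·_     : Fin n → Fin n → Fin n
    e       : Fin n
    inv     : Fin n → Fin n
    isGroup : IsGroup _≡_ _·_ e inv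

record IsGroupAut {n : ℕ} (G : FinGroup n) (θ : Fin n → Fin n) : Set where
  open FinGroup G
  field
    hom : ∀ x y → θ (x · y) ≡ θ x · θ y
    bij : Bijective _≡_ _≡_ θ

HasOrder2or3 : ∀ {n} → (Fin n → Fin n) → Set
HasOrder2or3 θ = ¬ (∀ g → θ g ≡ g) ×
  ((∀ g → θ (θ g) ≡ g) ⊎ (∀ g → θ (θ (θ g)) ≡ g))

module Quantities {np nl : ℕ} (Inc : Incidence np nl) (G : FinGroup np)
                  (θ : Fin np → Fin np) (θS : IsAutomorphism Inc θ) where
  open FinGroup G
  open IsAutomorphism θS using (lineMap)

  L₀ : Fin nl → Set
  L₀ ℓ = lineMap ℓ ≡ ℓ

  L₀? : Decidable L₀
  L₀? ℓ = lineMap ℓ ≟ ℓ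

  L₁ : Fin nl → Set
  L₁ ℓ = lineMap ℓ ≢ ℓ × ∃ λ x → _I_ Inc x ℓ × _I_ Inc x (lineMap ℓ)

  L₁? : Decidable L₁
  L₁? ℓ = ¬? (lineMap ℓ ≟ ℓ) ×-dec any? (λ x → _I?_ Inc x ℓ ×-dec _I?_ Inc x (lineMap ℓ))

  H : Fin np → Set
  H g = θ g ≡ g

  H? : Decidable H
  H? g = θ g ≟ g

  Δ : Fin np → Set
  Δ g = g ≢ e × ∃ λ m → _I_ Inc e m × _I_ Inc g m

  Δ? : Decidable Δ
  Δ? g = ¬? (g ≟ e) ×-dec any? (λ m → _I?_ Inc e m ×-dec _I?_ Inc g m)

  X : Fin np → Set
  X x = ∃ λ g → x ≡ θ g · inv g

  X? : Decidable X
  X? x = any? (λ g → x ≟ θ g · inv g)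

  X∩Δ? : Decidable (λ x → X x × Δ x)
  X∩Δ? x = X? x ×-dec Δ? x

  c : ℕ
  c = count (λ ℓ → _I?_ Inc e ℓ ×-dec L₀? ℓ)

module Submission where

-- Right multiplication by h ∈ H commutes with θ on lines. Hence if h fixes a line ℓ of L₁, it also
-- fixes ℓ^θ and therefore the point ℓ ∩ ℓ^θ, so h = 1.
-- For (2) count flags (x, ℓ) with ℓ fixed. A point x ∈ H lies on c fixed lines (translate the
-- fixed lines through 1 by x). A point x ∉ H lies on at most one fixed line, since such a line
-- contains x^θ, and on one exactly when x ~ x^θ, i.e. when x^θ x⁻¹ ∈ Δ. The fibres of
-- g ↦ g^θ g⁻¹ are the cosets gH, which turns the second contribution into |H|·|X ∩ Δ|.
-- Likewise every line of L₁ carries exactly one point of H, and through a point of H pass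
-- t + 1 − c moved lines, all in L₁. The order hypothesis enters through the fact that a line
-- through x ≠ x^θ and x^θ is fixed (dually, ℓ ∩ ℓ^θ is a fixed point): otherwise the θ-orbits
-- of x and ℓ would close up into a quadrangle or a triangle.

open import Defs
open import Data.Nat using (ℕ; zero; suc; _+_; _*_; _∸_; _≤_; s≤s)
open import Data.Nat.Properties
  using (+-identityʳ; ≤-pred; <⇒≤; +-comm; *-comm; *-assoc; *-distribˡ-+; m+n∸m≡n; +-*-semiring)
open import Data.Fin using (Fin; _≟_)
import Data.Fin as F
open import Data.Fin.Properties using (suc-injective; any?)
open import Data.Bool using (if_then_else_)
open import Data.Product using (_×_; _,_; proj₁; proj₂; ∃)
open import Data.Sum using (inj₁; inj₂)
open import Data.Empty using (⊥; ⊥-elim)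
open import Function using (_∘_; case_of_)
open import Function.Bundles using (mk⤖)
open import Function.Definitions using (Injective; Surjective; Bijective)
open import Function.Properties.Bijection using (⤖⇒↔)
import Function.Construct.Composition as Composition
open import Relation.Nullary using (¬_; Dec; yes; no; does)
open import Relation.Nullary.Decidable using (_×-dec_; ¬?; dec-false)
open import Relation.Unary using (Pred; Decidable)
open import Relation.Binary.PropositionalEquality
open import Algebra.Bundles using (Group)
open import Algebra.Structures using (IsGroup)
import Algebra.Properties.Group as GroupProperties
import Algebra.Properties.Quasigroup as QuasigroupProperties
open import Algebra.Properties.Semiring.Sum +-*-semiring
  using (sum-syntax; ∑-comm; ∑-permute; *-distribʳ-sum; sum-cong-≗; ∑-distrib-+)

𝟙 : ∀ {a} {A : Set a} → Dec A → ℕ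
𝟙 d = if does d then 1 else 0

module _ {a} {A : Set a} where

  𝟙≡0 : ¬ A → (x : Dec A) → 𝟙 x ≡ 0
  𝟙≡0 ¬a x = cong (λ b → if b then 1 else 0) (dec-false x ¬a)

  𝟙-*-cong : ∀ {m n} → (A → m ≡ n) → (x : Dec A) → 𝟙 x * m ≡ 𝟙 x * n
  𝟙-*-cong m≡n (yes a) = cong (_+ 0) (m≡n a)
  𝟙-*-cong m≡n (no _)  = refl

module _ {a b} {A : Set a} {B : Set b} where

  𝟙-cong : (A → B) → (B → A) → (x : Dec A) (y : Dec B) → 𝟙 x ≡ 𝟙 y
  𝟙-cong f g (yes p) (yes q) = refl
  𝟙-cong f g (yes p) (no ¬q) = ⊥-elim (¬q (f p))
  𝟙-cong f g (no ¬p) (yes q) = ⊥-elim (¬p (g q))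
  𝟙-cong f g (no ¬p) (no ¬q) = refl

  𝟙-×-dec : (x : Dec A) (y : Dec B) → 𝟙 (x ×-dec y) ≡ 𝟙 x * 𝟙 y
  𝟙-×-dec (yes _) y = sym (+-identityʳ (𝟙 y))
  𝟙-×-dec (no _)  y = refl

  𝟙-split : (x : Dec A) (y : Dec B) → 𝟙 x ≡ 𝟙 (x ×-dec y) + 𝟙 (x ×-dec ¬? y)
  𝟙-split (yes _) (yes _) = refl
  𝟙-split (yes _) (no _)  = refl
  𝟙-split (no _)  y       = refl

count≡sum : ∀ {n p} {P : Pred (Fin n) p} (P? : Decidable P) → count P? ≡ ∑[ i < n ] 𝟙 (P? i)
count≡sum {zero}  P? = refl
count≡sum {suc n} P? = cong (𝟙 (P? F.zero) +_) (count≡sum (P? ∘ F.suc))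

count-cong : ∀ {n p q} {P : Pred (Fin n) p} {Q : Pred (Fin n) q} (P? : Decidable P) (Q? : Decidable Q) →
             (∀ i → P i → Q i) → (∀ i → Q i → P i) → count P? ≡ count Q?
count-cong {zero}  P? Q? f g = refl
count-cong {suc n} P? Q? f g =
  cong₂ _+_ (𝟙-cong (f F.zero) (g F.zero) (P? F.zero) (Q? F.zero))
            (count-cong (P? ∘ F.suc) (Q? ∘ F.suc) (f ∘ F.suc) (g ∘ F.suc))

count-split : ∀ {n p q} {P : Pred (Fin n) p} {Q : Pred (Fin n) q} (P? : Decidable P) (Q? : Decidable Q) →
              count P? ≡ count (λ i → P? i ×-dec Q? i) + count (λ i → P? i ×-dec ¬? (Q? i))
count-split {n} {P = P} {Q} P? Q? = begin
  count P?                                        ≡⟨ count≡sum P? ⟩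
  ∑[ i < n ] 𝟙 (P? i)                             ≡⟨ sum-cong-≗ (λ i → 𝟙-split (P? i) (Q? i)) ⟩
  ∑[ i < n ] (𝟙 (P∩Q? i) + 𝟙 (P∖Q? i))            ≡⟨ ∑-distrib-+ (𝟙 ∘ P∩Q?) (𝟙 ∘ P∖Q?) ⟩
  ∑[ i < n ] 𝟙 (P∩Q? i) + ∑[ i < n ] 𝟙 (P∖Q? i)   ≡⟨ cong₂ _+_ (count≡sum P∩Q?) (count≡sum P∖Q?) ⟨
  count P∩Q? + count P∖Q?                         ∎
  where
  open ≡-Reasoning
  P∩Q? : Decidable (λ i → P i × Q i)
  P∩Q? i = P? i ×-dec Q? i
  P∖Q? : Decidable (λ i → P i × ¬ Q i)
  P∖Q? i = P? i ×-dec ¬? (Q? i)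

count≡0 : ∀ {n p} {P : Pred (Fin n) p} (P? : Decidable P) → (∀ i → ¬ P i) → count P? ≡ 0
count≡0 {zero}  P? ¬P = refl
count≡0 {suc n} P? ¬P with P? F.zero
... | yes p = ⊥-elim (¬P F.zero p)
... | no _  = count≡0 (P? ∘ F.suc) (¬P ∘ F.suc)

count≡1 : ∀ {n p} {P : Pred (Fin n) p} (P? : Decidable P) (a : Fin n) →
          P a → (∀ i → P i → i ≡ a) → count P? ≡ 1
count≡1 {suc n} P? F.zero Pa unique with P? F.zero
... | yes _ = cong suc (count≡0 (P? ∘ F.suc) (λ i Pi → case unique (F.suc i) Pi of λ ()))
... | no ¬Pa = ⊥-elim (¬Pa Pa)
count≡1 {suc n} P? (F.suc a) Pa unique with P? F.zero
... | yes P0 = case unique F.zero P0 of λ ()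
... | no _  = count≡1 (P? ∘ F.suc) a Pa (λ i Pi → suc-injective (unique (F.suc i) Pi))

count-×-const : ∀ {n p b} {P : Pred (Fin n) p} {B : Set b} (P? : Decidable P) (B? : Dec B) →
                count (λ i → P? i ×-dec B?) ≡ 𝟙 B? * count P?
count-×-const P? (yes b) = trans (count-cong _ P? (λ _ → proj₁) (λ _ p → p , b)) (sym (+-identityʳ _))
count-×-const P? (no ¬b) = count≡0 (λ i → P? i ×-dec no ¬b) (λ _ → ¬b ∘ proj₂)

∑-𝟙-*ʳ : ∀ {n p} {P : Pred (Fin n) p} (P? : Decidable P) k → ∑[ i < n ] (𝟙 (P? i) * k) ≡ count P? * k
∑-𝟙-*ʳ P? k = sym (trans (cong (_* k) (count≡sum P?)) (*-distribʳ-sum k (𝟙 ∘ P?)))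

∑-count-comm : ∀ {m n r} {R : Fin m → Fin n → Set r} (R? : ∀ i j → Dec (R i j)) →
               ∑[ i < m ] count (R? i) ≡ ∑[ j < n ] count (λ i → R? i j)
∑-count-comm {m} {n} R? = begin
  ∑[ i < m ] count (R? i)                ≡⟨ sum-cong-≗ (λ i → count≡sum (R? i)) ⟩
  ∑[ i < m ] ∑[ j < n ] 𝟙 (R? i j)       ≡⟨ ∑-comm (λ i j → 𝟙 (R? i j)) ⟩
  ∑[ j < n ] ∑[ i < m ] 𝟙 (R? i j)       ≡⟨ sym (sum-cong-≗ (λ j → count≡sum (λ i → R? i j))) ⟩
  ∑[ j < n ] count (λ i → R? i j)        ∎
  where open ≡-Reasoning

count-∘-bijective : ∀ {n p} {P : Pred (Fin n) p} (P? : Decidable P) {σ : Fin n → Fin n} →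
                    Bijective _≡_ _≡_ σ → count (P? ∘ σ) ≡ count P?
count-∘-bijective {n} P? {σ} σ-bij = begin
  count (P? ∘ σ)          ≡⟨ count≡sum (P? ∘ σ) ⟩
  ∑[ i < n ] 𝟙 (P? (σ i)) ≡⟨ sym (∑-permute (𝟙 ∘ P?) (⤖⇒↔ (mk⤖ σ-bij))) ⟩
  ∑[ i < n ] 𝟙 (P? i)     ≡⟨ sym (count≡sum P?) ⟩
  count P?                ∎
  where open ≡-Reasoning

count-≡-× : ∀ {n p} {P : Pred (Fin n) p} (P? : Decidable P) a → count (λ i → a ≟ i ×-dec P? i) ≡ 𝟙 (P? a)
count-≡-× P? a with P? a
... | yes Pa = count≡1 _ a (refl , Pa) (λ _ → sym ∘ proj₁)
... | no ¬Pa = count≡0 (λ i → a ≟ i ×-dec P? i) (λ { _ (refl , Pa) → ¬Pa Pa })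

count-∘ : ∀ {m n p} {P : Pred (Fin n) p} (P? : Decidable P) (φ : Fin m → Fin n) →
          count (P? ∘ φ) ≡ ∑[ j < n ] (𝟙 (P? j) * count (λ i → φ i ≟ j))
count-∘ {m} {n} P? φ = begin
  count (P? ∘ φ)                                       ≡⟨ count≡sum (P? ∘ φ) ⟩
  ∑[ i < m ] 𝟙 (P? (φ i))                              ≡⟨ sum-cong-≗ (λ i → sym (count-≡-× P? (φ i))) ⟩
  ∑[ i < m ] count (λ j → φ i ≟ j ×-dec P? j)          ≡⟨ ∑-count-comm (λ i j → φ i ≟ j ×-dec P? j) ⟩
  ∑[ j < n ] count (λ i → φ i ≟ j ×-dec P? j)          ≡⟨ sum-cong-≗ (λ j → count-×-const (λ i → φ i ≟ j) (P? j)) ⟩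
  ∑[ j < n ] (𝟙 (P? j) * count (λ i → φ i ≟ j))        ∎
  where open ≡-Reasoning

count>0⇒∃ : ∀ {n p} {P : Pred (Fin n) p} (P? : Decidable P) → 1 ≤ count P? → ∃ P
count>0⇒∃ {suc n} P? 1≤count with P? F.zero
... | yes P0 = F.zero , P0
... | no _   = let (i , Pi) = count>0⇒∃ (P? ∘ F.suc) 1≤count in F.suc i , Pi

count>1⇒distinct : ∀ {n p} {P : Pred (Fin n) p} (P? : Decidable P) → 2 ≤ count P? →
                   ∃ λ i → ∃ λ j → i ≢ j × P i × P j
count>1⇒distinct {suc n} P? 2≤count with P? F.zero
... | yes P0 = let (j , Pj) = count>0⇒∃ (P? ∘ F.suc) (≤-pred 2≤count) in F.zero , F.suc j , (λ ()) , P0 , Pj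
... | no _   = let (i , j , i≢j , Pi , Pj) = count>1⇒distinct (P? ∘ F.suc) 2≤count
               in F.suc i , F.suc j , i≢j ∘ suc-injective , Pi , Pj

module Displacement {n} (G : FinGroup n) (θ : Fin n → Fin n) (θ-aut : IsGroupAut G θ) where
  open FinGroup G
  open IsGroup isGroup using (assoc; identityˡ)
  open IsGroupAut θ-aut using (hom)

  group : Group _ _
  group = record { isGroup = isGroup }

  open GroupProperties group
    using (identityˡ-unique; x∙y⁻¹≈ε⇒x≈y; x≈y⇒x∙y⁻¹≈ε; ⁻¹-anti-homo-∙; \\-leftDividesˡ)
  open QuasigroupProperties (GroupProperties.quasigroup group) using (cancelˡ)

  displacement : Fin n → Fin n
  displacement g = θ g · inv g

  displacement≡e⇒fixed : ∀ {g} → displacement g ≡ e → θ g ≡ g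
  displacement≡e⇒fixed {g} = x∙y⁻¹≈ε⇒x≈y (θ g) g

  fixed⇒displacement≡e : ∀ {g} → θ g ≡ g → displacement g ≡ e
  fixed⇒displacement≡e = x≈y⇒x∙y⁻¹≈ε

  displacement-·ˡ : ∀ k g → displacement (k · g) ≡ θ k · (displacement g · inv k)
  displacement-·ˡ k g = begin
    θ (k · g) · inv (k · g)           ≡⟨ cong₂ _·_ (hom k g) (⁻¹-anti-homo-∙ k g) ⟩
    (θ k · θ g) · (inv g · inv k)     ≡⟨ assoc (θ k) (θ g) (inv g · inv k) ⟩
    θ k · (θ g · (inv g · inv k))     ≡⟨ cong (θ k ·_) (sym (assoc (θ g) (inv g) (inv k))) ⟩
    θ k · (displacement g · inv k)    ∎
    where open ≡-Reasoning

  displacement-fibre→ : ∀ k g → displacement (k · g) ≡ displacement k → θ g ≡ g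
  displacement-fibre→ k g eq = displacement≡e⇒fixed
    (identityˡ-unique (displacement g) (inv k) (cancelˡ (θ k) _ _ (trans (sym (displacement-·ˡ k g)) eq)))

  displacement-fibre← : ∀ k g → θ g ≡ g → displacement (k · g) ≡ displacement k
  displacement-fibre← k g θg≡g = begin
    displacement (k · g)              ≡⟨ displacement-·ˡ k g ⟩
    θ k · (displacement g · inv k)    ≡⟨ cong (λ d → θ k · (d · inv k)) (fixed⇒displacement≡e θg≡g) ⟩
    θ k · (e · inv k)                 ≡⟨ cong (θ k ·_) (identityˡ (inv k)) ⟩
    displacement k                    ∎
    where open ≡-Reasoning

  ·ˡ-bijective : ∀ k → Bijective _≡_ _≡_ (k ·_)
  ·ˡ-bijective k = (λ {g} {h} → cancelˡ k g h) , λ g → inv k · g , λ { refl → \\-leftDividesˡ k g }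

  count-displacement-fibre : ∀ y → count (λ g → displacement g ≟ y) ≡
                             𝟙 (any? (λ g → y ≟ displacement g)) * count (λ g → θ g ≟ g)
  count-displacement-fibre y with any? (λ g → y ≟ displacement g)
  ... | yes (k , refl) = begin
    count (λ g → displacement g ≟ y)            ≡⟨ sym (count-∘-bijective (λ g → displacement g ≟ y) (·ˡ-bijective k)) ⟩
    count (λ g → displacement (k · g) ≟ y)      ≡⟨ count-cong _ _ (displacement-fibre→ k) (displacement-fibre← k) ⟩
    count (λ g → θ g ≟ g)                       ≡⟨ sym (+-identityʳ _) ⟩
    1 * count (λ g → θ g ≟ g)                   ∎
    where open ≡-Reasoning
  ... | no y∉X = count≡0 (λ g → displacement g ≟ y) (λ g eq → y∉X (g , sym eq))

orbit-distinct : ∀ {n} {σ : Fin n → Fin n} → Injective _≡_ _≡_ σ → (∀ a → σ (σ (σ a)) ≡ a) →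
                 ∀ {a} → a ≢ σ a → σ a ≢ σ (σ a) × a ≢ σ (σ a)
orbit-distinct {σ = σ} σ-inj σ³≡id {a} a≢σa =
  a≢σa ∘ σ-inj , λ a≡σ²a → a≢σa (sym (trans (cong σ a≡σ²a) (σ³≡id a)))

module Quadrangle {np nl} (Inc : Incidence np nl) {s t} (gq : IsGQ Inc s t) (s≥1 : 1 ≤ s) where
  open IsGQ gq

  infix 4 _∈_
  _∈_ : Fin np → Fin nl → Set
  x ∈ ℓ = _I_ Inc x ℓ

  Collinear : Fin np → Fin np → Set
  Collinear x y = ∃ λ ℓ → x ∈ ℓ × y ∈ ℓ

  Collinear? : ∀ x y → Dec (Collinear x y)
  Collinear? x y = any? (λ ℓ → _I?_ Inc x ℓ ×-dec _I?_ Inc y ℓ)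

  unique-line : ∀ {x y ℓ m} → x ≢ y → x ∈ ℓ → y ∈ ℓ → x ∈ m → y ∈ m → ℓ ≡ m
  unique-line {x} {y} {ℓ} {m} x≢y x∈ℓ y∈ℓ x∈m y∈m with ℓ ≟ m
  ... | yes ℓ≡m = ℓ≡m
  ... | no ℓ≢m  = ⊥-elim (no-4-cycle x y ℓ m x≢y ℓ≢m x∈ℓ y∈ℓ x∈m y∈m)

  unique-point : ∀ {x y ℓ m} → ℓ ≢ m → x ∈ ℓ → y ∈ ℓ → x ∈ m → y ∈ m → x ≡ y
  unique-point {x} {y} {ℓ} {m} ℓ≢m x∈ℓ y∈ℓ x∈m y∈m with x ≟ y
  ... | yes x≡y = x≡y
  ... | no x≢y  = ⊥-elim (no-4-cycle x y ℓ m x≢y ℓ≢m x∈ℓ y∈ℓ x∈m y∈m)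

  ⊆⇒≡ : ∀ {ℓ m} → (∀ x → x ∈ ℓ → x ∈ m) → ℓ ≡ m
  ⊆⇒≡ {ℓ} ℓ⊆m =
    let (x , y , x≢y , x∈ℓ , y∈ℓ) = count>1⇒distinct (λ x → _I?_ Inc x ℓ)
                                      (subst (2 ≤_) (sym (points-per-line ℓ)) (s≤s s≥1))
    in unique-line x≢y x∈ℓ y∈ℓ (ℓ⊆m x x∈ℓ) (ℓ⊆m y y∈ℓ)

  Preserving : (Fin np → Fin np) → (Fin nl → Fin nl) → Set
  Preserving f L = ∀ x ℓ → Inc x ℓ ≡ Inc (f x) (L ℓ)

  module _ {f L} (f-L : Preserving f L) where

    map-∈ : ∀ {x ℓ} → x ∈ ℓ → f x ∈ L ℓ
    map-∈ {x} {ℓ} x∈ℓ = trans (sym (f-L x ℓ)) x∈ℓ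

    unmap-∈ : ∀ {x ℓ} → f x ∈ L ℓ → x ∈ ℓ
    unmap-∈ {x} {ℓ} fx∈Lℓ = trans (f-L x ℓ) fx∈Lℓ

    ∘-preserving : ∀ {g M} → Preserving g M → Preserving (g ∘ f) (M ∘ L)
    ∘-preserving g-M x ℓ = trans (f-L x ℓ) (g-M (f x) (L ℓ))

    lineMap-trivial : (∀ x → f x ≡ x) → ∀ ℓ → L ℓ ≡ ℓ
    lineMap-trivial f≗id ℓ = sym (⊆⇒≡ λ x x∈ℓ → subst (_∈ L ℓ) (f≗id x) (map-∈ x∈ℓ))

  lineMap-unique : ∀ {f L L′} → Surjective _≡_ _≡_ f → Preserving f L → Preserving f L′ → ∀ ℓ → L ℓ ≡ L′ ℓ
  lineMap-unique {f} {L} f-surj f-L f-L′ ℓ = ⊆⇒≡ λ y y∈Lℓ →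
    let (x , fx≡y) = f-surj y in
    subst (_∈ _) (fx≡y refl) (map-∈ f-L′ (unmap-∈ f-L (subst (_∈ L ℓ) (sym (fx≡y refl)) y∈Lℓ)))

  module CollineationOfOrder2or3 {θ : Fin np → Fin np} (θS : IsAutomorphism Inc θ) (θ-order : HasOrder2or3 θ) where
    open IsAutomorphism θS renaming (lineMap to Lθ; preserves to θ-preserving)

    θ-injective : Injective _≡_ _≡_ θ
    θ-injective = proj₁ point-bij

    Lθ-injective : Injective _≡_ _≡_ Lθ
    Lθ-injective = proj₁ line-bij

    fixed-lines-through : ∀ x → Decidable (λ ℓ → x ∈ ℓ × Lθ ℓ ≡ ℓ)
    fixed-lines-through x ℓ = _I?_ Inc x ℓ ×-dec Lθ ℓ ≟ ℓ

    moved-lines-through : ∀ x → Decidable (λ ℓ → x ∈ ℓ × Lθ ℓ ≢ ℓ)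
    moved-lines-through x ℓ = _I?_ Inc x ℓ ×-dec ¬? (Lθ ℓ ≟ ℓ)

    image-on-fixed-line : ∀ {x ℓ} → Lθ ℓ ≡ ℓ → x ∈ ℓ → θ x ∈ ℓ
    image-on-fixed-line Lθℓ≡ℓ x∈ℓ = subst (_ ∈_) Lθℓ≡ℓ (map-∈ θ-preserving x∈ℓ)

    fixed-point-on-image-line : ∀ {x ℓ} → θ x ≡ x → x ∈ ℓ → x ∈ Lθ ℓ
    fixed-point-on-image-line θx≡x x∈ℓ = subst (_∈ _) θx≡x (map-∈ θ-preserving x∈ℓ)

    Lθ³≡id : (∀ x → θ (θ (θ x)) ≡ x) → ∀ ℓ → Lθ (Lθ (Lθ ℓ)) ≡ ℓ
    Lθ³≡id θ³≡id = lineMap-trivial (∘-preserving θ-preserving (∘-preserving θ-preserving θ-preserving)) θ³≡id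

    -- x, θx (and θ²x) together with ℓ, θℓ (and θ²ℓ) would form a 4-cycle (a 6-cycle) in the incidence graph.
    no-moved-chord : ∀ {x ℓ} → x ≢ θ x → ℓ ≢ Lθ ℓ → x ∈ ℓ → θ x ∈ ℓ → ⊥
    no-moved-chord {x} {ℓ} x≢θx ℓ≢Lθℓ x∈ℓ θx∈ℓ with proj₂ θ-order
    ... | inj₁ θ²≡id = no-4-cycle x (θ x) ℓ (Lθ ℓ) x≢θx ℓ≢Lθℓ x∈ℓ θx∈ℓ
                         (subst (_∈ Lθ ℓ) (θ²≡id x) (map-∈ θ-preserving θx∈ℓ)) (map-∈ θ-preserving x∈ℓ)
    ... | inj₂ θ³≡id =
      let (θx≢θ²x , x≢θ²x) = orbit-distinct θ-injective θ³≡id x≢θx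
          (Lθℓ≢Lθ²ℓ , ℓ≢Lθ²ℓ) = orbit-distinct Lθ-injective (Lθ³≡id θ³≡id) ℓ≢Lθℓ
          θ²-preserving = ∘-preserving θ-preserving θ-preserving
      in no-6-cycle x (θ x) (θ (θ x)) ℓ (Lθ ℓ) (Lθ (Lθ ℓ)) x≢θx θx≢θ²x x≢θ²x ℓ≢Lθℓ Lθℓ≢Lθ²ℓ ℓ≢Lθ²ℓ
           x∈ℓ θx∈ℓ (map-∈ θ-preserving x∈ℓ) (map-∈ θ-preserving θx∈ℓ) (map-∈ θ²-preserving x∈ℓ)
           (subst (_∈ Lθ (Lθ ℓ)) (θ³≡id x) (map-∈ θ²-preserving θx∈ℓ))

    join-with-image-fixed : ∀ {x ℓ} → θ x ≢ x → x ∈ ℓ → θ x ∈ ℓ → Lθ ℓ ≡ ℓ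
    join-with-image-fixed {x} {ℓ} θx≢x x∈ℓ θx∈ℓ with Lθ ℓ ≟ ℓ
    ... | yes Lθℓ≡ℓ = Lθℓ≡ℓ
    ... | no Lθℓ≢ℓ  = ⊥-elim (no-moved-chord (θx≢x ∘ sym) (Lθℓ≢ℓ ∘ sym) x∈ℓ θx∈ℓ)

    meet-with-image-fixed : ∀ {x ℓ} → Lθ ℓ ≢ ℓ → x ∈ ℓ → x ∈ Lθ ℓ → θ x ≡ x
    meet-with-image-fixed {x} {ℓ} Lθℓ≢ℓ x∈ℓ x∈Lθℓ with θ x ≟ x
    ... | yes θx≡x = θx≡x
    ... | no θx≢x  = ⊥-elim (no-moved-chord (θx≢x ∘ sym) (Lθℓ≢ℓ ∘ Lθ-injective ∘ sym)
                                            x∈Lθℓ (map-∈ θ-preserving x∈ℓ))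

    count-fixed-lines-through-moved-point : ∀ {x} → θ x ≢ x → count (fixed-lines-through x) ≡ 𝟙 (Collinear? x (θ x))
    count-fixed-lines-through-moved-point {x} θx≢x with Collinear? x (θ x)
    ... | yes (m , x∈m , θx∈m) = count≡1 _ m (x∈m , join-with-image-fixed θx≢x x∈m θx∈m)
            λ ℓ (x∈ℓ , Lθℓ≡ℓ) → unique-line (θx≢x ∘ sym) x∈ℓ (image-on-fixed-line Lθℓ≡ℓ x∈ℓ) x∈m θx∈m
    ... | no ¬collinear = count≡0 (fixed-lines-through x)
            λ ℓ (x∈ℓ , Lθℓ≡ℓ) → ¬collinear (ℓ , x∈ℓ , image-on-fixed-line Lθℓ≡ℓ x∈ℓ)

module RegularMultiplier {np nl} (Inc : Incidence np nl) {s t} (gq : IsGQ Inc s t) (s≥1 : 1 ≤ s)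
  (G : FinGroup np) (act : (g : Fin np) → IsAutomorphism Inc (λ x → FinGroup._·_ G x g))
  (θ : Fin np → Fin np) (θ-aut : IsGroupAut G θ) (θS : IsAutomorphism Inc θ) (θ-order : HasOrder2or3 θ) where
  open FinGroup G
  open IsGroup isGroup using (identityˡ; inverseʳ)
  open IsGroupAut θ-aut using (hom)
  open IsGQ gq using (points-per-line; lines-per-point)
  open Quadrangle Inc gq s≥1
  open CollineationOfOrder2or3 θS θ-order
  open Displacement G θ θ-aut
  open GroupProperties group using (identityʳ-unique; //-rightDividesˡ)
  open Quantities Inc G θ θS
  open IsAutomorphism θS using () renaming (lineMap to Lθ; preserves to θ-preserving)

  L : Fin np → Fin nl → Fin nl
  L g = IsAutomorphism.lineMap (act g)

  ·-preserving : ∀ g → Preserving (_· g) (L g)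
  ·-preserving g = IsAutomorphism.preserves (act g)

  centralizer-commutes : ∀ {h} → H h → ∀ ℓ → Lθ (L h ℓ) ≡ L h (Lθ ℓ)
  centralizer-commutes {h} θh≡h = lineMap-unique θ∘·h-surjective
    (∘-preserving (·-preserving h) θ-preserving)
    (λ x ℓ → trans (∘-preserving θ-preserving (·-preserving h) x ℓ) (cong (λ y → Inc y (L h (Lθ ℓ))) (θ-·h x)))
    where
    θ-·h : ∀ x → θ x · h ≡ θ (x · h)
    θ-·h x = sym (trans (hom x h) (cong (θ x ·_) θh≡h))
    θ∘·h-surjective : Surjective _≡_ _≡_ (θ ∘ (_· h))
    θ∘·h-surjective = Composition.surjective _≡_ _≡_ _≡_
      (proj₂ (IsAutomorphism.point-bij (act h))) (proj₂ (IsAutomorphism.point-bij θS))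

  centralizer-semiregular-on-L₁ : ∀ h ℓ → H h → L₁ ℓ → L h ℓ ≡ ℓ → h ≡ e
  centralizer-semiregular-on-L₁ h ℓ θh≡h (Lθℓ≢ℓ , x , x∈ℓ , x∈Lθℓ) Lhℓ≡ℓ =
    identityʳ-unique x h (unique-point (Lθℓ≢ℓ ∘ sym) xh∈ℓ x∈ℓ xh∈Lθℓ x∈Lθℓ)
    where
    xh∈ℓ : x · h ∈ ℓ
    xh∈ℓ = subst (x · h ∈_) Lhℓ≡ℓ (map-∈ (·-preserving h) x∈ℓ)
    xh∈Lθℓ : x · h ∈ Lθ ℓ
    xh∈Lθℓ = subst (x · h ∈_) (trans (sym (centralizer-commutes θh≡h ℓ)) (cong Lθ Lhℓ≡ℓ))
                   (map-∈ (·-preserving h) x∈Lθℓ)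

  count-fixed-lines-through-centralizer : ∀ {x} → H x → count (fixed-lines-through x) ≡ c
  count-fixed-lines-through-centralizer {x} θx≡x = begin
    count (fixed-lines-through x)          ≡⟨ count-∘-bijective (fixed-lines-through x) (IsAutomorphism.line-bij (act x)) ⟨
    count (fixed-lines-through x ∘ L x)    ≡⟨ count-cong _ (fixed-lines-through e) to from ⟩
    c                                      ∎
    where
    open ≡-Reasoning
    Lx-injective : Injective _≡_ _≡_ (L x)
    Lx-injective = proj₁ (IsAutomorphism.line-bij (act x))
    to : ∀ ℓ → x ∈ L x ℓ × L₀ (L x ℓ) → e ∈ ℓ × L₀ ℓ
    to ℓ (x∈Lxℓ , LxℓFixed) = unmap-∈ (·-preserving x) (subst (_∈ L x ℓ) (sym (identityˡ x)) x∈Lxℓ)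
                            , Lx-injective (trans (sym (centralizer-commutes θx≡x ℓ)) LxℓFixed)
    from : ∀ ℓ → e ∈ ℓ × L₀ ℓ → x ∈ L x ℓ × L₀ (L x ℓ)
    from ℓ (e∈ℓ , ℓFixed) = subst (_∈ L x ℓ) (identityˡ x) (map-∈ (·-preserving x) e∈ℓ)
                          , trans (centralizer-commutes θx≡x ℓ) (cong (L x) ℓFixed)

  collinear-·ʳ : ∀ {x y} g → Collinear x y → Collinear (x · g) (y · g)
  collinear-·ʳ g (ℓ , x∈ℓ , y∈ℓ) = L g ℓ , map-∈ (·-preserving g) x∈ℓ , map-∈ (·-preserving g) y∈ℓ

  collinear-image⇒Δ : ∀ {x} → θ x ≢ x → Collinear x (θ x) → Δ (displacement x)
  collinear-image⇒Δ {x} θx≢x x~θx =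
    θx≢x ∘ displacement≡e⇒fixed , subst (λ y → Collinear y (displacement x)) (inverseʳ x) (collinear-·ʳ (inv x) x~θx)

  Δ⇒collinear-image : ∀ {x} → Δ (displacement x) → Collinear x (θ x)
  Δ⇒collinear-image {x} (_ , 1~d) = subst₂ Collinear (identityˡ x) (//-rightDividesˡ x (θ x)) (collinear-·ʳ x 1~d)

  count-fixed-lines-through : ∀ x → count (fixed-lines-through x) ≡ 𝟙 (H? x) * c + 𝟙 (Δ? (displacement x))
  count-fixed-lines-through x with H? x
  ... | yes θx≡x = begin
    count (fixed-lines-through x)       ≡⟨ count-fixed-lines-through-centralizer θx≡x ⟩
    c                                   ≡⟨ +-identityʳ c ⟨
    c + 0                               ≡⟨ cong₂ _+_ (+-identityʳ c) (𝟙≡0 d∉Δ (Δ? (displacement x))) ⟨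
    1 * c + 𝟙 (Δ? (displacement x))     ∎
    where
    open ≡-Reasoning
    d∉Δ : ¬ Δ (displacement x)
    d∉Δ (d≢e , _) = d≢e (fixed⇒displacement≡e θx≡x)
  ... | no θx≢x  = trans (count-fixed-lines-through-moved-point θx≢x)
                         (𝟙-cong (collinear-image⇒Δ θx≢x) Δ⇒collinear-image (Collinear? x (θ x)) (Δ? _))

  count-L₀-flags : count L₀? * (1 + s) ≡ ∑[ x < np ] count (fixed-lines-through x)
  count-L₀-flags = begin
    count L₀? * (1 + s)                                   ≡⟨ ∑-𝟙-*ʳ L₀? (1 + s) ⟨
    ∑[ ℓ < nl ] (𝟙 (L₀? ℓ) * suc s)                       ≡⟨ sum-cong-≗ (λ ℓ → cong (𝟙 (L₀? ℓ) *_) (points-per-line ℓ)) ⟨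
    ∑[ ℓ < nl ] (𝟙 (L₀? ℓ) * count (λ x → _I?_ Inc x ℓ))  ≡⟨ sum-cong-≗ (λ ℓ → count-×-const (λ x → _I?_ Inc x ℓ) (L₀? ℓ)) ⟨
    ∑[ ℓ < nl ] count (λ x → fixed-lines-through x ℓ)     ≡⟨ ∑-count-comm fixed-lines-through ⟨
    ∑[ x < np ] count (fixed-lines-through x)             ∎
    where open ≡-Reasoning

  count-Δ∘displacement : count (Δ? ∘ displacement) ≡ count X∩Δ? * count H?
  count-Δ∘displacement = begin
    count (Δ? ∘ displacement)                                  ≡⟨ count-∘ Δ? displacement ⟩
    ∑[ y < np ] (𝟙 (Δ? y) * count (λ x → displacement x ≟ y)) ≡⟨ sum-cong-≗ (λ y → cong (𝟙 (Δ? y) *_) (count-displacement-fibre y)) ⟩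
    ∑[ y < np ] (𝟙 (Δ? y) * (𝟙 (X? y) * count H?))            ≡⟨ sum-cong-≗ (λ y → 𝟙X∩Δ-* y) ⟩
    ∑[ y < np ] (𝟙 (X∩Δ? y) * count H?)                        ≡⟨ ∑-𝟙-*ʳ X∩Δ? (count H?) ⟩
    count X∩Δ? * count H?                                      ∎
    where
    open ≡-Reasoning
    𝟙X∩Δ-* : ∀ y → 𝟙 (Δ? y) * (𝟙 (X? y) * count H?) ≡ 𝟙 (X∩Δ? y) * count H?
    𝟙X∩Δ-* y = begin
      𝟙 (Δ? y) * (𝟙 (X? y) * count H?)   ≡⟨ sym (*-assoc (𝟙 (Δ? y)) (𝟙 (X? y)) (count H?)) ⟩
      𝟙 (Δ? y) * 𝟙 (X? y) * count H?     ≡⟨ cong (_* count H?) (*-comm (𝟙 (Δ? y)) (𝟙 (X? y))) ⟩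
      𝟙 (X? y) * 𝟙 (Δ? y) * count H?     ≡⟨ cong (_* count H?) (sym (𝟙-×-dec (X? y) (Δ? y))) ⟩
      𝟙 (X∩Δ? y) * count H?              ∎

  count-L₀ : count L₀? * (1 + s) ≡ count H? * (c + count X∩Δ?)
  count-L₀ = begin
    count L₀? * (1 + s)                                               ≡⟨ count-L₀-flags ⟩
    ∑[ x < np ] count (fixed-lines-through x)                         ≡⟨ sum-cong-≗ count-fixed-lines-through ⟩
    ∑[ x < np ] (𝟙 (H? x) * c + 𝟙 (Δ? (displacement x)))              ≡⟨ ∑-distrib-+ (λ x → 𝟙 (H? x) * c) (𝟙 ∘ Δ? ∘ displacement) ⟩
    ∑[ x < np ] (𝟙 (H? x) * c) + ∑[ x < np ] 𝟙 (Δ? (displacement x)) ≡⟨ cong₂ _+_ (∑-𝟙-*ʳ H? c) (sym (count≡sum (Δ? ∘ displacement))) ⟩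
    count H? * c + count (Δ? ∘ displacement)                          ≡⟨ cong (count H? * c +_) count-Δ∘displacement ⟩
    count H? * c + count X∩Δ? * count H?                              ≡⟨ cong (count H? * c +_) (*-comm (count X∩Δ?) (count H?)) ⟩
    count H? * c + count H? * count X∩Δ?                              ≡⟨ sym (*-distribˡ-+ (count H?) c (count X∩Δ?)) ⟩
    count H? * (c + count X∩Δ?)                                       ∎
    where open ≡-Reasoning

  centralizer-flags : ∀ x → Decidable (λ ℓ → (x ∈ ℓ × Lθ ℓ ≢ ℓ) × H x)
  centralizer-flags x ℓ = moved-lines-through x ℓ ×-dec H? x

  𝟙L₁≡count-centralizer-points : ∀ ℓ → 𝟙 (L₁? ℓ) ≡ count (λ x → centralizer-flags x ℓ)
  𝟙L₁≡count-centralizer-points ℓ = by-cases (L₁? ℓ)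
    where
    by-cases : (L₁ℓ? : Dec (L₁ ℓ)) → 𝟙 L₁ℓ? ≡ count (λ x → centralizer-flags x ℓ)
    by-cases (yes (Lθℓ≢ℓ , x , x∈ℓ , x∈Lθℓ)) =
      sym (count≡1 _ x ((x∈ℓ , Lθℓ≢ℓ) , meet-with-image-fixed Lθℓ≢ℓ x∈ℓ x∈Lθℓ)
             λ y ((y∈ℓ , _) , θy≡y) →
               unique-point (Lθℓ≢ℓ ∘ sym) y∈ℓ x∈ℓ (fixed-point-on-image-line θy≡y y∈ℓ) x∈Lθℓ)
    by-cases (no ¬L₁ℓ) = sym (count≡0 (λ x → centralizer-flags x ℓ)
             λ x ((x∈ℓ , Lθℓ≢ℓ) , θx≡x) →
               ¬L₁ℓ (Lθℓ≢ℓ , x , x∈ℓ , fixed-point-on-image-line θx≡x x∈ℓ))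

  count-moved-lines-through-centralizer : ∀ {x} → H x → count (moved-lines-through x) ≡ t + 1 ∸ c
  count-moved-lines-through-centralizer {x} θx≡x = begin
    moved             ≡⟨ m+n∸m≡n c moved ⟨
    c + moved ∸ c     ≡⟨ cong (_∸ c) lines-through-x ⟨
    suc t ∸ c         ≡⟨ cong (_∸ c) (+-comm 1 t) ⟩
    t + 1 ∸ c         ∎
    where
    open ≡-Reasoning
    moved = count (moved-lines-through x)
    lines-through-x : suc t ≡ c + moved
    lines-through-x = begin
      suc t                                   ≡⟨ lines-per-point x ⟨
      count (_I?_ Inc x)                      ≡⟨ count-split (_I?_ Inc x) L₀? ⟩
      count (fixed-lines-through x) + moved   ≡⟨ cong (_+ moved) (count-fixed-lines-through-centralizer θx≡x) ⟩
      c + moved                               ∎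

  count-L₁ : count L₁? ≡ (t + 1 ∸ c) * count H?
  count-L₁ = begin
    count L₁?                                                   ≡⟨ count≡sum L₁? ⟩
    ∑[ ℓ < nl ] 𝟙 (L₁? ℓ)                                       ≡⟨ sum-cong-≗ 𝟙L₁≡count-centralizer-points ⟩
    ∑[ ℓ < nl ] count (λ x → centralizer-flags x ℓ)             ≡⟨ ∑-count-comm centralizer-flags ⟨
    ∑[ x < np ] count (centralizer-flags x)                     ≡⟨ sum-cong-≗ (λ x → count-×-const (moved-lines-through x) (H? x)) ⟩
    ∑[ x < np ] (𝟙 (H? x) * count (moved-lines-through x))      ≡⟨ sum-cong-≗ (λ x → 𝟙-*-cong count-moved-lines-through-centralizer (H? x)) ⟩
    ∑[ x < np ] (𝟙 (H? x) * (t + 1 ∸ c))                        ≡⟨ ∑-𝟙-*ʳ H? (t + 1 ∸ c) ⟩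
    count H? * (t + 1 ∸ c)                                      ≡⟨ *-comm (count H?) (t + 1 ∸ c) ⟩
    (t + 1 ∸ c) * count H?                                      ∎
    where open ≡-Reasoning

proposition3p2 : {np nl : ℕ} (Inc : Incidence np nl) (s t : ℕ) →
    IsGQ Inc s t → 2 ≤ s → 2 ≤ t →
    (G : FinGroup np) →
    (act : (g : Fin np) → IsAutomorphism Inc (λ x → FinGroup._·_ G x g)) →
    (θ : Fin np → Fin np) → IsGroupAut G θ → (θS : IsAutomorphism Inc θ) →
    HasOrder2or3 θ →
    let open Quantities Inc G θ θS in
    ((h : Fin np) (ℓ : Fin nl) → H h → L₁ ℓ →
       IsAutomorphism.lineMap (act h) ℓ ≡ ℓ → h ≡ FinGroup.e G)
    ×
    (count L₀? * (1 + s) ≡ count H? * (c + count X∩Δ?)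
     × count L₁? ≡ (t + 1 ∸ c) * count H?)
proposition3p2 Inc s t gq 2≤s _ G act θ θ-aut θS θ-order =
  centralizer-semiregular-on-L₁ , count-L₀ , count-L₁
  where open RegularMultiplier Inc gq (<⇒≤ 2≤s) G act θ θ-aut θS θ-order
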